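{- Let $G$ be an undirected graph, $c:E(G)\to\mathbb{R}_{>0}$, $\mathcal{T}\subseteq V(G)$ and $r\in\mathcal{T}$. Let $O\subseteq V(G)\times 2^{\mathcal{T}\setminus\{r\}}$ be the set of pairs $(v,I)$ such that some optimum Steiner tree for $\mathcal{T}$ contains a $(v,I)$-subtree. Let $(v,I)\in O$ and let $T_1$ be a tree containing $\{v\}\cup I$ with $c(T_1)=\mathrm{smt}(\{v\}\cup I)$. Then there is an optimum Steiner tree $T$ for $\mathcal{T}$ containing $T_1$ as a $(v,I)$-subtree.
   Context: $\mathrm{smt}(X)$ is the minimum cost of a tree in $G$ containing $X$; a Steiner tree for $\mathcal{T}$ is a tree containing $\mathcal{T}$, optimum if its cost equals $\mathrm{smt}(\mathcal{T})$. For a Steiner tree $T$ for $\mathcal{T}$ and $(v,I)\in V(G)\times2^{\mathcal{T}}$, a tree $T_1$ is a $(v,I)$-subtree of $T$ if there is a tree $T_2$ with $V(T_1)\cup V(T_2)=V(T)$, $V(T_1)\cap V(T_2)=\{v\}$, $T_1$ a subtree of $T$ containing $\{v\}\cup I$, and $T_2$ a subtree of $T$ containing $\{v\}\cup(\mathcal{T}\setminus I)$.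
   Formalization: The edge costs c take positive rational values rather than positive real values. -}

module Defs where

open import Data.Nat using (ℕ; zero; suc)
open import Data.Fin using (Fin; zero; suc)
open import Data.Fin.Subset using (Subset; _∈_; _⊆_; _∪_; _∩_; ⁅_⁆; _-_; _─_)
open import Data.Vec using ([]; _∷_)
open import Data.Bool using (true; false)
open import Data.Rational using (ℚ; 0ℚ; _+_; _≤_; _<_)
open import Data.List using (List; []; _∷_)
open import Data.List.Relation.Unary.Unique.Propositional using (Unique)
open import Data.Product using (Σ; ∃; _×_; _,_; proj₁; proj₂)
open import Data.Sum using (_⊎_)
open import Relation.Binary.PropositionalEquality using (_≡_)

-- A finite undirected (multi)graph: vertices Fin n, edges Fin m,
-- each edge with an (unordered) pair of endpoints.
record Graph : Set where
  field
    n : ℕ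
    m : ℕ
    ends : Fin m → Fin n × Fin n
open Graph public

Joins : (G : Graph) → Fin (m G) → Fin (n G) → Fin (n G) → Set
Joins G e u x = ends G e ≡ (u , x) ⊎ ends G e ≡ (x , u)

record Subgraph (G : Graph) : Set where
  field
    V : Subset (n G)
    E : Subset (m G)
    closed : ∀ e → e ∈ E → proj₁ (ends G e) ∈ V × proj₂ (ends G e) ∈ V
open Subgraph public

data Walk {G : Graph} (H : Subgraph G) : Fin (n G) → Fin (n G) → List (Fin (m G)) → Set where
  nil  : ∀ {u} → u ∈ V H → Walk H u u []
  cons : ∀ {u x w es} (e : Fin (m G)) → e ∈ E H → u ∈ V H → Joins G e u x →
         Walk H x w es → Walk H u w (e ∷ es)

Connected : {G : Graph} → Subgraph G → Set
Connected {G} H = ∀ (u w : Fin (n G)) → u ∈ V H → w ∈ V H → ∃ λ es → Walk H u w es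

Acyclic : {G : Graph} → Subgraph G → Set
Acyclic {G} H = ∀ (u : Fin (n G)) (es : List (Fin (m G))) → Walk H u u es → Unique es → es ≡ []

IsTree : {G : Graph} → Subgraph G → Set
IsTree {G} H = (∃ λ (v : Fin (n G)) → v ∈ V H) × Connected H × Acyclic H

_≼_ : {G : Graph} → Subgraph G → Subgraph G → Set
H₁ ≼ H₂ = V H₁ ⊆ V H₂ × E H₁ ⊆ E H₂

sumOver : ∀ {k} → (Fin k → ℚ) → Subset k → ℚ
sumOver c [] = 0ℚ
sumOver c (true ∷ s) = c zero + sumOver (λ i → c (suc i)) s
sumOver c (false ∷ s) = sumOver (λ i → c (suc i)) s

cost : (G : Graph) → (Fin (m G) → ℚ) → Subgraph G → ℚ
cost G c H = sumOver c (E H)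

TreeContaining : (G : Graph) → Subset (n G) → Subgraph G → Set
TreeContaining G X T = IsTree T × X ⊆ V T

MinTree : (G : Graph) → (Fin (m G) → ℚ) → Subset (n G) → Subgraph G → Set
MinTree G c X T = TreeContaining G X T × (∀ (T' : Subgraph G) → TreeContaining G X T' → cost G c T ≤ cost G c T')

OptSteiner : (G : Graph) → (Fin (m G) → ℚ) → Subset (n G) → Subgraph G → Set
OptSteiner G c 𝒯 T = MinTree G c 𝒯 T

IsSubtreeOf : {G : Graph} → Subgraph G → Subgraph G → Set
IsSubtreeOf T₁ T = IsTree T₁ × T₁ ≼ T

IsVISubtree : (G : Graph) → Subset (n G) → Subgraph G → Fin (n G) → Subset (n G) → Subgraph G → Set
IsVISubtree G 𝒯 T v I T₁ =
  Σ (Subgraph G) λ T₂ →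
    (V T₁ ∪ V T₂ ≡ V T) ×
    (V T₁ ∩ V T₂ ≡ ⁅ v ⁆) ×
    IsSubtreeOf T₁ T × (⁅ v ⁆ ∪ I) ⊆ V T₁ ×
    IsSubtreeOf T₂ T × (⁅ v ⁆ ∪ (𝒯 ─ I)) ⊆ V T₂

InO : (G : Graph) → (Fin (m G) → ℚ) → Subset (n G) → Fin (n G) → Fin (n G) → Subset (n G) → Set
InO G c 𝒯 r v I =
  I ⊆ (𝒯 - r) ×
  Σ (Subgraph G) λ T → OptSteiner G c 𝒯 T × Σ (Subgraph G) λ T₁' → IsVISubtree G 𝒯 T v I T₁'

{-# OPTIONS --safe #-}
-- Let T be an optimum Steiner tree that splits at v into T₁′ ⊇ {v} ∪ I and T₂ ⊇ {v} ∪ (𝒯 ∖ I).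
-- T₁′ and T₂ share no edge (it would be a loop at v), so U = T₁ ∪ T₂ is connected, contains 𝒯,
-- and c(U) ≤ c(T₁) + c(T₂) ≤ c(T₁′) + c(T₂) ≤ c(T). With positive costs a connected subgraph
-- containing 𝒯 never beats smt(𝒯): deleting an edge of a cycle keeps it connected and makes it
-- cheaper, so a cheapest one is a tree. Hence all the inequalities are tight: U is acyclic, so it
-- is an optimum Steiner tree, and T₁, T₂ are edge-disjoint. A second common vertex of T₁ and T₂
-- would then close a cycle in U, so V(T₁) ∩ V(T₂) = {v}.
module Submission where

open import Algebra.Bundles using (CommutativeMonoid)
open import Data.Bool using (true; false)
open import Data.Empty using (⊥-elim)
open import Data.Fin using (Fin; zero; suc; _≟_)
open import Data.Fin.Subset
  using (Subset; _∈_; _∉_; _⊆_; _⊂_; _∪_; _∩_; _─_; _-_; ⁅_⁆; ⊥; ∣_∣; Nonempty; Empty)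
open import Data.Fin.Subset.Properties
  using ( _∈?_; Empty-unique; drop-∷-⊆; ⊆-min; ∉⊥; ⊆-antisym; x∈⁅x⁆; x∈⁅y⁆⇒x≡y; p⊆p∪q; q⊆p∪q
        ; x∈p∪q⁺; x∈p∪q⁻; x∈p∩q⁺; x∈p∩q⁻; p─q⊆p; x∈p∧x∉q⇒x∈p─q; x∈p∧x≢y⇒x∈p-y; x∈p⇒p-x⊂p; x∈p⇒∣p-x∣<∣p∣)
open import Data.List using (List; []; _∷_; _++_)
open import Data.Vec using ([]; _∷_; here; there)
open import Data.List.Properties using (++-conicalˡ)
open import Data.List.Membership.Propositional using () renaming (_∈_ to _∈ₗ_; _∉_ to _∉ₗ_)
open import Data.List.Relation.Unary.All using ([])
open import Data.List.Relation.Unary.All.Properties using (¬Any⇒All¬; All¬⇒¬Any)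
open import Data.List.Relation.Unary.AllPairs using ([]; _∷_)
open import Data.List.Relation.Unary.Any using (here; there; any?)
open import Data.List.Relation.Unary.Unique.Propositional using (Unique)
open import Data.List.Relation.Unary.Unique.Propositional.Properties using (++⁺)
import Data.Nat as ℕ
import Data.Nat.Properties as ℕ
open import Data.Product using (Σ; ∃; ∃₂; _×_; _,_; proj₁; proj₂; map₂)
import Data.Product as Product
open import Data.Rational using (ℚ; 0ℚ; _+_; _≤_; _<_)
open import Data.Rational.Properties
  using ( ≤-refl; ≤-trans; <⇒≤; <-trans; <-irrefl; <-≤-trans; ≤-<-trans; ≮⇒≥; +-assoc; +-comm; +-identityˡ; +-identityʳ
        ; +-mono-≤; +-monoˡ-≤; +-monoʳ-≤; +-mono-≤-<; +-mono-<-≤; +-monoʳ-<; +-0-commutativeMonoid; module ≤-Reasoning)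
open import Algebra.Properties.CommutativeSemigroup (CommutativeMonoid.commutativeSemigroup +-0-commutativeMonoid)
  using (interchange; x∙yz≈y∙xz)
open import Data.Sum using (_⊎_; inj₁; inj₂; [_,_]′)
open import Function using (_∘_)
open import Relation.Nullary using (¬_; yes; no)
open import Relation.Binary.PropositionalEquality
  using (_≡_; _≢_; refl; sym; trans; cong; cong₂; subst; module ≡-Reasoning)

open import Defs

q≤r⇒q≤p+r : ∀ {p q r} → 0ℚ ≤ p → q ≤ r → q ≤ p + r
q≤r⇒q≤p+r {q = q} 0≤p q≤r = subst (_≤ _) (+-identityˡ q) (+-mono-≤ 0≤p q≤r)

q<r⇒q<p+r : ∀ {p q r} → 0ℚ ≤ p → q < r → q < p + r
q<r⇒q<p+r {q = q} 0≤p q<r = subst (_< _) (+-identityˡ q) (+-mono-≤-< 0≤p q<r)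

q≤r⇒q<p+r : ∀ {p q r} → 0ℚ < p → q ≤ r → q < p + r
q≤r⇒q<p+r {q = q} 0<p q≤r = subst (_< _) (+-identityˡ q) (+-mono-<-≤ 0<p q≤r)

⊆-∪-split : ∀ {k} {X I A B : Subset k} → I ⊆ A → X ─ I ⊆ B → X ⊆ A ∪ B
⊆-∪-split {I = I} {A} {B} I⊆A X─I⊆B {x} x∈X with x ∈? I
... | yes x∈I = p⊆p∪q B (I⊆A x∈I)
... | no x∉I = q⊆p∪q A B (X─I⊆B (x∈p∧x∉q⇒x∈p─q x∈X x∉I))

x∈p∧unique⇒p≡⁅x⁆ : ∀ {k} {x : Fin k} {p : Subset k} →
                   x ∈ p → (∀ {y} → y ∈ p → y ≡ x) → p ≡ ⁅ x ⁆
x∈p∧unique⇒p≡⁅x⁆ {x = x} {p} x∈p unique = ⊆-antisym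
  (λ y∈p → subst (_∈ ⁅ x ⁆) (sym (unique y∈p)) (x∈⁅x⁆ x))
  (λ {y} y∈⁅x⁆ → subst (_∈ p) (sym (x∈⁅y⁆⇒x≡y x y∈⁅x⁆)) x∈p)

sumOver-⊥ : ∀ {k} (c : Fin k → ℚ) → sumOver c ⊥ ≡ 0ℚ
sumOver-⊥ {ℕ.zero} c = refl
sumOver-⊥ {ℕ.suc k} c = sumOver-⊥ (c ∘ suc)

sumOver-mono : ∀ {k} (c : Fin k → ℚ) → (∀ i → 0ℚ ≤ c i) →
               {A B : Subset k} → A ⊆ B → sumOver c A ≤ sumOver c B
sumOver-mono c c≥0 {[]} {[]} A⊆B = ≤-refl
sumOver-mono c c≥0 {true ∷ A} {true ∷ B} A⊆B =
  +-monoʳ-≤ (c zero) (sumOver-mono (c ∘ suc) (c≥0 ∘ suc) (drop-∷-⊆ A⊆B))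
sumOver-mono c c≥0 {true ∷ A} {false ∷ B} A⊆B with () ← A⊆B here
sumOver-mono c c≥0 {false ∷ A} {true ∷ B} A⊆B =
  q≤r⇒q≤p+r (c≥0 zero) (sumOver-mono (c ∘ suc) (c≥0 ∘ suc) (drop-∷-⊆ A⊆B))
sumOver-mono c c≥0 {false ∷ A} {false ∷ B} A⊆B = sumOver-mono (c ∘ suc) (c≥0 ∘ suc) (drop-∷-⊆ A⊆B)

sumOver-nonneg : ∀ {k} (c : Fin k → ℚ) → (∀ i → 0ℚ ≤ c i) → (A : Subset k) → 0ℚ ≤ sumOver c A
sumOver-nonneg c c≥0 A = subst (_≤ sumOver c A) (sumOver-⊥ c) (sumOver-mono c c≥0 (⊆-min A))

sumOver-strictMono : ∀ {k} (c : Fin k → ℚ) → (∀ i → 0ℚ < c i) →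
                     {A B : Subset k} → A ⊂ B → sumOver c A < sumOver c B
sumOver-strictMono c c>0 {false ∷ A} {true ∷ B} (A⊆B , zero , _ , _) =
  q≤r⇒q<p+r (c>0 zero) (sumOver-mono (c ∘ suc) (<⇒≤ ∘ c>0 ∘ suc) (drop-∷-⊆ A⊆B))
sumOver-strictMono c c>0 {true ∷ A} (_ , zero , _ , i∉A) with () ← i∉A here
sumOver-strictMono c c>0 {true ∷ A} {true ∷ B} (A⊆B , suc i , there i∈B , i∉A) =
  +-monoʳ-< (c zero) (sumOver-strictMono (c ∘ suc) (c>0 ∘ suc) (drop-∷-⊆ A⊆B , i , i∈B , i∉A ∘ there))
sumOver-strictMono c c>0 {true ∷ A} {false ∷ B} (A⊆B , suc i , _ , _) with () ← A⊆B here
sumOver-strictMono c c>0 {false ∷ A} {true ∷ B} (A⊆B , suc i , there i∈B , i∉A) =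
  q<r⇒q<p+r (<⇒≤ (c>0 zero)) (sumOver-strictMono (c ∘ suc) (c>0 ∘ suc) (drop-∷-⊆ A⊆B , i , i∈B , i∉A ∘ there))
sumOver-strictMono c c>0 {false ∷ A} {false ∷ B} (A⊆B , suc i , there i∈B , i∉A) =
  sumOver-strictMono (c ∘ suc) (c>0 ∘ suc) (drop-∷-⊆ A⊆B , i , i∈B , i∉A ∘ there)

sumOver-∪-∩ : ∀ {k} (c : Fin k → ℚ) (A B : Subset k) →
              sumOver c (A ∪ B) + sumOver c (A ∩ B) ≡ sumOver c A + sumOver c B
sumOver-∪-∩ c [] [] = refl
sumOver-∪-∩ c (true ∷ A) (true ∷ B) = begin
  (c zero + s (A ∪ B)) + (c zero + s (A ∩ B)) ≡⟨ interchange (c zero) (s (A ∪ B)) (c zero) (s (A ∩ B)) ⟩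
  (c zero + c zero) + (s (A ∪ B) + s (A ∩ B)) ≡⟨ cong (c zero + c zero +_) (sumOver-∪-∩ (c ∘ suc) A B) ⟩
  (c zero + c zero) + (s A + s B)             ≡⟨ interchange (c zero) (c zero) (s A) (s B) ⟩
  (c zero + s A) + (c zero + s B)             ∎
  where open ≡-Reasoning; s = sumOver (c ∘ suc)
sumOver-∪-∩ c (true ∷ A) (false ∷ B) = begin
  (c zero + s (A ∪ B)) + s (A ∩ B) ≡⟨ +-assoc (c zero) (s (A ∪ B)) (s (A ∩ B)) ⟩
  c zero + (s (A ∪ B) + s (A ∩ B)) ≡⟨ cong (c zero +_) (sumOver-∪-∩ (c ∘ suc) A B) ⟩
  c zero + (s A + s B)             ≡⟨ +-assoc (c zero) (s A) (s B) ⟨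
  (c zero + s A) + s B             ∎
  where open ≡-Reasoning; s = sumOver (c ∘ suc)
sumOver-∪-∩ c (false ∷ A) (true ∷ B) = begin
  (c zero + s (A ∪ B)) + s (A ∩ B) ≡⟨ +-assoc (c zero) (s (A ∪ B)) (s (A ∩ B)) ⟩
  c zero + (s (A ∪ B) + s (A ∩ B)) ≡⟨ cong (c zero +_) (sumOver-∪-∩ (c ∘ suc) A B) ⟩
  c zero + (s A + s B)             ≡⟨ x∙yz≈y∙xz (c zero) (s A) (s B) ⟩
  s A + (c zero + s B)             ∎
  where open ≡-Reasoning; s = sumOver (c ∘ suc)
sumOver-∪-∩ c (false ∷ A) (false ∷ B) = sumOver-∪-∩ (c ∘ suc) A B

sumOver-∪-≤ : ∀ {k} (c : Fin k → ℚ) → (∀ i → 0ℚ ≤ c i) → (A B : Subset k) →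
              sumOver c (A ∪ B) ≤ sumOver c A + sumOver c B
sumOver-∪-≤ c c≥0 A B = begin
  sumOver c (A ∪ B)                     ≤⟨ q≤r⇒q≤p+r (sumOver-nonneg c c≥0 (A ∩ B)) ≤-refl ⟩
  sumOver c (A ∩ B) + sumOver c (A ∪ B) ≡⟨ +-comm (sumOver c (A ∩ B)) (sumOver c (A ∪ B)) ⟩
  sumOver c (A ∪ B) + sumOver c (A ∩ B) ≡⟨ sumOver-∪-∩ c A B ⟩
  sumOver c A + sumOver c B             ∎
  where open ≤-Reasoning

sumOver-∪-< : ∀ {k} (c : Fin k → ℚ) → (∀ i → 0ℚ < c i) → (A B : Subset k) → Nonempty (A ∩ B) →
              sumOver c (A ∪ B) < sumOver c A + sumOver c B
sumOver-∪-< c c>0 A B (i , i∈A∩B) = begin-strict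
  sumOver c (A ∪ B)                     <⟨ q≤r⇒q<p+r 0<s∩ ≤-refl ⟩
  sumOver c (A ∩ B) + sumOver c (A ∪ B) ≡⟨ +-comm (sumOver c (A ∩ B)) (sumOver c (A ∪ B)) ⟩
  sumOver c (A ∪ B) + sumOver c (A ∩ B) ≡⟨ sumOver-∪-∩ c A B ⟩
  sumOver c A + sumOver c B             ∎
  where
  open ≤-Reasoning
  0<s∩ : 0ℚ < sumOver c (A ∩ B)
  0<s∩ = subst (_< sumOver c (A ∩ B)) (sumOver-⊥ c)
               (sumOver-strictMono c c>0 (⊆-min (A ∩ B) , i , i∈A∩B , ∉⊥))

sumOver-∪-disjoint : ∀ {k} (c : Fin k → ℚ) (A B : Subset k) → Empty (A ∩ B) →
                     sumOver c (A ∪ B) ≡ sumOver c A + sumOver c B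
sumOver-∪-disjoint c A B A∩B-empty = begin
  sumOver c (A ∪ B)                     ≡⟨ +-identityʳ _ ⟨
  sumOver c (A ∪ B) + 0ℚ                ≡⟨ cong (sumOver c (A ∪ B) +_) s∩≡0 ⟨
  sumOver c (A ∪ B) + sumOver c (A ∩ B) ≡⟨ sumOver-∪-∩ c A B ⟩
  sumOver c A + sumOver c B             ∎
  where
  open ≡-Reasoning
  s∩≡0 : sumOver c (A ∩ B) ≡ 0ℚ
  s∩≡0 = trans (cong (sumOver c) (Empty-unique A∩B-empty)) (sumOver-⊥ c)

module _ {G : Graph} where

  _⊖_ : Subgraph G → Fin (m G) → Subgraph G
  H ⊖ e = record { V = V H ; E = E H - e ; closed = λ f f∈ → closed H f (p─q⊆p (E H) ⁅ e ⁆ f∈) }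

  infixl 25 _∪ᴳ_
  infixl 25 _⊖_

  _∪ᴳ_ : Subgraph G → Subgraph G → Subgraph G
  H₁ ∪ᴳ H₂ = record { V = V H₁ ∪ V H₂ ; E = E H₁ ∪ E H₂ ; closed = closed-∪ }
    where
    closed-∪ : ∀ e → e ∈ E H₁ ∪ E H₂ →
               proj₁ (ends G e) ∈ V H₁ ∪ V H₂ × proj₂ (ends G e) ∈ V H₁ ∪ V H₂
    closed-∪ e e∈ with x∈p∪q⁻ (E H₁) (E H₂) e∈
    ... | inj₁ e∈₁ = Product.map (p⊆p∪q (V H₂)) (p⊆p∪q (V H₂)) (closed H₁ e e∈₁)
    ... | inj₂ e∈₂ = Product.map (q⊆p∪q (V H₁) (V H₂)) (q⊆p∪q (V H₁) (V H₂)) (closed H₂ e e∈₂)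

  ≼-∪ᴳˡ : ∀ (H₁ H₂ : Subgraph G) → H₁ ≼ H₁ ∪ᴳ H₂
  ≼-∪ᴳˡ H₁ H₂ = p⊆p∪q (V H₂) , p⊆p∪q (E H₂)

  ≼-∪ᴳʳ : ∀ (H₁ H₂ : Subgraph G) → H₂ ≼ H₁ ∪ᴳ H₂
  ≼-∪ᴳʳ H₁ H₂ = q⊆p∪q (V H₁) (V H₂) , q⊆p∪q (E H₁) (E H₂)

  Joins-sym : ∀ {e u x} → Joins G e u x → Joins G e x u
  Joins-sym (inj₁ p) = inj₂ p
  Joins-sym (inj₂ p) = inj₁ p

  Joins-endpoints : ∀ {e u x a b} → Joins G e u x → Joins G e a b → (a ≡ u × b ≡ x) ⊎ (a ≡ x × b ≡ u)
  Joins-endpoints (inj₁ p) (inj₁ q) = inj₁ (cong proj₁ (trans (sym q) p) , cong proj₂ (trans (sym q) p))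
  Joins-endpoints (inj₁ p) (inj₂ q) = inj₂ (cong proj₂ (trans (sym q) p) , cong proj₁ (trans (sym q) p))
  Joins-endpoints (inj₂ p) (inj₁ q) = inj₂ (cong proj₁ (trans (sym q) p) , cong proj₂ (trans (sym q) p))
  Joins-endpoints (inj₂ p) (inj₂ q) = inj₁ (cong proj₂ (trans (sym q) p) , cong proj₁ (trans (sym q) p))

  module _ {H : Subgraph G} where

    walk-start∈ : ∀ {u w es} → Walk H u w es → u ∈ V H
    walk-start∈ (nil u∈) = u∈
    walk-start∈ (cons _ _ u∈ _ _) = u∈

    walk-[]⇒≡ : ∀ {u w} → Walk H u w [] → u ≡ w
    walk-[]⇒≡ (nil _) = refl

    walk-edges⊆ : ∀ {u w es e} → Walk H u w es → e ∈ₗ es → e ∈ E H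
    walk-edges⊆ (cons _ e∈ _ _ _) (here refl) = e∈
    walk-edges⊆ (cons _ _ _ _ W) (there e∈es) = walk-edges⊆ W e∈es

    _++ʷ_ : ∀ {u x w es fs} → Walk H u x es → Walk H x w fs → Walk H u w (es ++ fs)
    nil _ ++ʷ W′ = W′
    cons e e∈ u∈ J W ++ʷ W′ = cons e e∈ u∈ J (W ++ʷ W′)

    walk-reverse : ∀ {u w es} → Walk H u w es → ∃ (Walk H w u)
    walk-reverse (nil u∈) = _ , nil u∈
    walk-reverse (cons e e∈ u∈ J W) =
      _ , proj₂ (walk-reverse W) ++ʷ cons e e∈ (walk-start∈ W) (Joins-sym J) (nil u∈)

    walk-avoid : ∀ {f u w es} → Walk H u w es → f ∉ₗ es → Walk (H ⊖ f) u w es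
    walk-avoid (nil u∈) f∉ = nil u∈
    walk-avoid (cons e e∈ u∈ J W) f∉ =
      cons e (x∈p∧x≢y⇒x∈p-y e∈ (f∉ ∘ here ∘ sym)) u∈ J (walk-avoid W (f∉ ∘ there))

    trail-after : ∀ {x w es e} → Walk H x w es → e ∈ₗ es → Unique es →
                  ∃₂ λ a b → Joins G e a b × Σ (List (Fin (m G))) λ fs → Walk H b w fs × Unique (e ∷ fs)
    trail-after (cons _ _ _ J W) (here refl) uq = _ , _ , J , _ , W , uq
    trail-after (cons _ _ _ _ W) (there e∈es) (_ ∷ uq) = trail-after W e∈es uq

    walk⇒trail : ∀ {u w es} → Walk H u w es → Σ (List (Fin (m G))) λ fs → Walk H u w fs × Unique fs
    walk⇒trail (nil u∈) = [] , nil u∈ , []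
    walk⇒trail (cons e e∈ u∈ J W) with walk⇒trail W
    ... | fs , W′ , uq with any? (e ≟_) fs
    ...   | no e∉fs = e ∷ fs , cons e e∈ u∈ J W′ , ¬Any⇒All¬ fs e∉fs ∷ uq
    -- e recurs in the trail: skip the closed detour between its two occurrences.
    ...   | yes e∈fs with trail-after W′ e∈fs uq
    ...     | a , b , J′ , gs , W″ , uq′ with Joins-endpoints J J′
    ...       | inj₁ (refl , refl) = e ∷ gs , cons e e∈ u∈ J′ W″ , uq′
    ...       | inj₂ (_ , refl) with _ ∷ uq″ ← uq′ = gs , W″ , uq″

  walk-mono : ∀ {H H′ : Subgraph G} → H ≼ H′ → ∀ {u w es} → Walk H u w es → Walk H′ u w es
  walk-mono H≼H′ (nil u∈) = nil (proj₁ H≼H′ u∈)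
  walk-mono H≼H′ (cons e e∈ u∈ J W) = cons e (proj₂ H≼H′ e∈) (proj₁ H≼H′ u∈) J (walk-mono H≼H′ W)

  ⊖-Connected : ∀ {H : Subgraph G} {e a b} → Connected H → Joins G e a b →
                ∃ (Walk (H ⊖ e) b a) → Connected (H ⊖ e)
  ⊖-Connected {H} {e} conn J (_ , P) u w u∈ w∈ = reroute (proj₂ (conn u w u∈ w∈))
    where
    reroute : ∀ {x y es} → Walk H x y es → ∃ (Walk (H ⊖ e) x y)
    reroute (nil x∈) = _ , nil x∈
    reroute (cons f f∈ x∈ J′ W) with f ≟ e
    ... | no f≢e = _ , cons f (x∈p∧x≢y⇒x∈p-y f∈ f≢e) x∈ J′ (proj₂ (reroute W))
    ... | yes refl with Joins-endpoints J J′
    ...   | inj₁ (refl , refl) = _ , proj₂ (walk-reverse P) ++ʷ proj₂ (reroute W)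
    ...   | inj₂ (refl , refl) = _ , P ++ʷ proj₂ (reroute W)

  minimallyConnected⇒Acyclic : ∀ {H : Subgraph G} → Connected H →
                               (∀ {e} → e ∈ E H → ¬ Connected (H ⊖ e)) → Acyclic H
  minimallyConnected⇒Acyclic conn minimal u [] _ _ = refl
  minimallyConnected⇒Acyclic conn minimal u (e ∷ es) (cons e e∈ u∈ J W) (e∉es ∷ _) =
    ⊥-elim (minimal e∈ (⊖-Connected conn J (_ , walk-avoid W (All¬⇒¬Any e∉es))))

  ∪ᴳ-Connected : ∀ {H₁ H₂ : Subgraph G} {v} → Connected H₁ → Connected H₂ →
                 v ∈ V H₁ → v ∈ V H₂ → Connected (H₁ ∪ᴳ H₂)
  ∪ᴳ-Connected {H₁} {H₂} {v} conn₁ conn₂ v∈₁ v∈₂ u w u∈ w∈ =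
    _ , proj₂ (proj₁ (via u∈)) ++ʷ proj₂ (proj₂ (via w∈))
    where
    via : ∀ {x} → x ∈ V (H₁ ∪ᴳ H₂) → ∃ (Walk (H₁ ∪ᴳ H₂) x v) × ∃ (Walk (H₁ ∪ᴳ H₂) v x)
    via {x} x∈ with x∈p∪q⁻ (V H₁) (V H₂) x∈
    ... | inj₁ x∈₁ = map₂ (walk-mono (≼-∪ᴳˡ H₁ H₂)) (conn₁ x v x∈₁ v∈₁)
                   , map₂ (walk-mono (≼-∪ᴳˡ H₁ H₂)) (conn₁ v x v∈₁ x∈₁)
    ... | inj₂ x∈₂ = map₂ (walk-mono (≼-∪ᴳʳ H₁ H₂)) (conn₂ x v x∈₂ v∈₂)
                   , map₂ (walk-mono (≼-∪ᴳʳ H₁ H₂)) (conn₂ v x v∈₂ x∈₂)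

  ∪ᴳ-Acyclic⇒∩-unique : ∀ {H₁ H₂ : Subgraph G} → Acyclic (H₁ ∪ᴳ H₂) → Connected H₁ → Connected H₂ →
                        Empty (E H₁ ∩ E H₂) →
                        ∀ {u w} → u ∈ V H₁ ∩ V H₂ → w ∈ V H₁ ∩ V H₂ → u ≡ w
  ∪ᴳ-Acyclic⇒∩-unique {H₁} {H₂} acyclic conn₁ conn₂ disjoint {u} {w} u∈ w∈
    with es , P , uq₁ ← walk⇒trail (proj₂ (conn₁ u w (proj₁ (x∈p∩q⁻ _ _ u∈)) (proj₁ (x∈p∩q⁻ _ _ w∈))))
       | fs , Q , uq₂ ← walk⇒trail (proj₂ (conn₂ w u (proj₂ (x∈p∩q⁻ _ _ w∈)) (proj₂ (x∈p∩q⁻ _ _ u∈))))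
    = walk-[]⇒≡ (subst (Walk H₁ u w) (++-conicalˡ es fs es++fs≡[]) P)
    where
    es++fs≡[] : es ++ fs ≡ []
    es++fs≡[] = acyclic u (es ++ fs) (walk-mono (≼-∪ᴳˡ H₁ H₂) P ++ʷ walk-mono (≼-∪ᴳʳ H₁ H₂) Q)
                  (++⁺ uq₁ uq₂ λ {e} (e∈es , e∈fs) →
                     disjoint (e , x∈p∩q⁺ (walk-edges⊆ P e∈es , walk-edges⊆ Q e∈fs)))

  Acyclic⇒loopless : ∀ {H : Subgraph G} {e v} → Acyclic H → e ∈ E H → ¬ ends G e ≡ (v , v)
  Acyclic⇒loopless {H} {e} {v} acyclic e∈ loop =
    nonempty (acyclic v (e ∷ []) (cons e e∈ v∈ (inj₁ loop) (nil v∈)) ([] ∷ []))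
    where
    v∈ : v ∈ V H
    v∈ = subst (λ p → proj₁ p ∈ V H) loop (proj₁ (closed H e e∈))
    nonempty : e ∷ [] ≢ []
    nonempty ()

  ∩≡⁅v⁆⇒edge-disjoint : ∀ {H₁ H₂ : Subgraph G} {v} →
                        V H₁ ∩ V H₂ ≡ ⁅ v ⁆ → Acyclic H₂ → Empty (E H₁ ∩ E H₂)
  ∩≡⁅v⁆⇒edge-disjoint {H₁} {H₂} {v} V∩≡⁅v⁆ acyclic (e , e∈) = loop (x∈p∩q⁻ (E H₁) (E H₂) e∈)
    where
    ≡v : ∀ {x} → x ∈ V H₁ → x ∈ V H₂ → x ≡ v
    ≡v x∈₁ x∈₂ = x∈⁅y⁆⇒x≡y v (subst (_ ∈_) V∩≡⁅v⁆ (x∈p∩q⁺ (x∈₁ , x∈₂)))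
    loop : ¬ (e ∈ E H₁ × e ∈ E H₂)
    loop (e∈₁ , e∈₂) = Acyclic⇒loopless acyclic e∈₂
      (cong₂ _,_ (≡v (proj₁ (closed H₁ e e∈₁)) (proj₁ (closed H₂ e e∈₂)))
                 (≡v (proj₂ (closed H₁ e e∈₁)) (proj₂ (closed H₂ e e∈₂))))

module _ {G : Graph} {c : Fin (m G) → ℚ} (c>0 : ∀ e → 0ℚ < c e) where

  cost-⊖ : ∀ {H : Subgraph G} {e} → e ∈ E H → cost G c (H ⊖ e) < cost G c H
  cost-⊖ e∈ = sumOver-strictMono c c>0 (x∈p⇒p-x⊂p e∈)

  disjoint-cost-≤ : ∀ {H₁ H₂ H : Subgraph G} → Empty (E H₁ ∩ E H₂) → H₁ ≼ H → H₂ ≼ H →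
                    cost G c H₁ + cost G c H₂ ≤ cost G c H
  disjoint-cost-≤ {H₁} {H₂} {H} disjoint (_ , E₁⊆) (_ , E₂⊆) =
    subst (_≤ cost G c H) (sumOver-∪-disjoint c (E H₁) (E H₂) disjoint)
          (sumOver-mono c (<⇒≤ ∘ c>0) (λ e∈ → [ E₁⊆ , E₂⊆ ]′ (x∈p∪q⁻ (E H₁) (E H₂) e∈)))

  MinTree-cost-≤ : ∀ {X T H} → MinTree G c X T → Connected H → Nonempty (V H) → X ⊆ V H →
                   cost G c T ≤ cost G c H
  MinTree-cost-≤ {X} {T} {H} min conn ne X⊆ = ≮⇒≥ (go (ℕ.suc ∣ E H ∣) H ℕ.≤-refl conn ne X⊆)
    where
    -- Stated as ≮ so that acyclicity of H can be proved by contradiction: deleting a cycle edge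
    -- would give a cheaper connected subgraph with fewer edges.
    go : ∀ k H → ∣ E H ∣ ℕ.< k → Connected H → Nonempty (V H) → X ⊆ V H → ¬ cost G c H < cost G c T
    go (ℕ.suc k) H |E|<k conn ne X⊆ H<T =
      <-irrefl refl (<-≤-trans H<T (proj₂ min H ((ne , conn , acyclic) , X⊆)))
      where
      acyclic : Acyclic H
      acyclic = minimallyConnected⇒Acyclic conn λ {e} e∈ conn′ →
        go k (H ⊖ e) (ℕ.<-≤-trans (x∈p⇒∣p-x∣<∣p∣ e∈) (ℕ.≤-pred |E|<k)) conn′ ne X⊆
           (<-trans (cost-⊖ {H} e∈) H<T)

  cost-≤-MinTree⇒MinTree : ∀ {X T H} → MinTree G c X T → Connected H → Nonempty (V H) → X ⊆ V H →
                            cost G c H ≤ cost G c T → MinTree G c X H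
  cost-≤-MinTree⇒MinTree {H = H} min conn ne X⊆ H≤T =
    ((ne , conn , acyclic) , X⊆) , λ T′ t → ≤-trans H≤T (proj₂ min T′ t)
    where
    acyclic : Acyclic H
    acyclic = minimallyConnected⇒Acyclic conn λ {e} e∈ conn′ →
      <-irrefl refl (≤-<-trans (MinTree-cost-≤ min conn′ ne X⊆) (<-≤-trans (cost-⊖ {H} e∈) H≤T))

lemma7 : (G : Graph) (c : Fin (m G) → ℚ) → (∀ e → 0ℚ < c e) →
    (𝒯 : Subset (n G)) (r : Fin (n G)) → _∈_ {n G} r 𝒯 →
    (v : Fin (n G)) (I : Subset (n G)) → InO G c 𝒯 r v I →
    (T₁ : Subgraph G) → MinTree G c (⁅ v ⁆ ∪ I) T₁ →
    Σ (Subgraph G) λ T → OptSteiner G c 𝒯 T × IsVISubtree G 𝒯 T v I T₁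
lemma7 G c c>0 𝒯 _ _ v I
       (_ , T , optT , T₁′ , T₂ , _ , V∩≡⁅v⁆′ , (treeT₁′ , T₁′≼T) , vI⊆T₁′ , (treeT₂ , T₂≼T) , vJ⊆T₂)
       T₁ ((treeT₁ , vI⊆T₁) , minimalT₁) =
  U , optU , T₂ , refl , V∩≡⁅v⁆ , (treeT₁ , ≼-∪ᴳˡ T₁ T₂) , vI⊆T₁ , (treeT₂ , ≼-∪ᴳʳ T₁ T₂) , vJ⊆T₂
  where
  U : Subgraph G
  U = T₁ ∪ᴳ T₂
  v∈₁ : v ∈ V T₁
  v∈₁ = vI⊆T₁ (x∈p∪q⁺ (inj₁ (x∈⁅x⁆ v)))
  v∈₂ : v ∈ V T₂
  v∈₂ = vJ⊆T₂ (x∈p∪q⁺ (inj₁ (x∈⁅x⁆ v)))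
  connT₁ : Connected T₁
  connT₁ = proj₁ (proj₂ treeT₁)
  connT₂ : Connected T₂
  connT₂ = proj₁ (proj₂ treeT₂)
  connU : Connected U
  connU = ∪ᴳ-Connected connT₁ connT₂ v∈₁ v∈₂
  neU : Nonempty (V U)
  neU = v , p⊆p∪q (V T₂) v∈₁
  𝒯⊆U : 𝒯 ⊆ V U
  𝒯⊆U = ⊆-∪-split (vI⊆T₁ ∘ q⊆p∪q ⁅ v ⁆ I) (vJ⊆T₂ ∘ q⊆p∪q ⁅ v ⁆ (𝒯 ─ I))
  T₁′T₂-disjoint : Empty (E T₁′ ∩ E T₂)
  T₁′T₂-disjoint = ∩≡⁅v⁆⇒edge-disjoint {H₁ = T₁′} {T₂} V∩≡⁅v⁆′ (proj₂ (proj₂ treeT₂))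
  T₁+T₂≤T : cost G c T₁ + cost G c T₂ ≤ cost G c T
  T₁+T₂≤T = ≤-trans (+-monoˡ-≤ (cost G c T₂) (minimalT₁ T₁′ (treeT₁′ , vI⊆T₁′)))
                    (disjoint-cost-≤ c>0 {T₁′} {T₂} {T} T₁′T₂-disjoint T₁′≼T T₂≼T)
  optU : OptSteiner G c 𝒯 U
  optU = cost-≤-MinTree⇒MinTree c>0 optT connU neU 𝒯⊆U
           (≤-trans (sumOver-∪-≤ c (<⇒≤ ∘ c>0) (E T₁) (E T₂)) T₁+T₂≤T)
  acyclicU : Acyclic U
  acyclicU = proj₂ (proj₂ (proj₁ (proj₁ optU)))
  T₁T₂-disjoint : Empty (E T₁ ∩ E T₂)
  T₁T₂-disjoint shared = <-irrefl refl (≤-<-trans (MinTree-cost-≤ c>0 optT connU neU 𝒯⊆U)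
                                         (<-≤-trans (sumOver-∪-< c c>0 (E T₁) (E T₂) shared) T₁+T₂≤T))
  V∩≡⁅v⁆ : V T₁ ∩ V T₂ ≡ ⁅ v ⁆
  V∩≡⁅v⁆ = x∈p∧unique⇒p≡⁅x⁆ (x∈p∩q⁺ (v∈₁ , v∈₂)) λ x∈ →
    ∪ᴳ-Acyclic⇒∩-unique acyclicU connT₁ connT₂ T₁T₂-disjoint x∈ (x∈p∩q⁺ (v∈₁ , v∈₂))
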